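{- Let $k$, $n$ and $s$ be positive integers and let $x_1,\ldots,x_n$ be independent variables; write $E_j^{(s)}=E_j^{(s)}(x_1,\ldots,x_n)$ and $H_j^{(s)}=H_j^{(s)}(x_1,\ldots,x_n)$. Then $$2kE_k^{(s)}=\sum_{k_1+k_2+k_3=k}(-1)^{k_3}(k_1+k_2)E_{k_1}^{(s)}E_{k_2}^{(s)}H_{k_3}^{(s)}$$ and $$kH_k^{(s)}=\sum_{k_1+k_2+k_3=k}(-1)^{k_3-1}k_3H_{k_1}^{(s)}H_{k_2}^{(s)}E_{k_3}^{(s)},$$ where the sums are over nonnegative integers $k_1,k_2,k_3$.
   Context: For a positive integer $s$, $H_k^{(s)}$ and $E_k^{(s)}$ ($k\ge0$) are defined by the formal power series identities $$\sum_{k\ge0}H_k^{(s)}(x_1,\ldots,x_n)t^k=\prod_{i=1}^n\big(1-x_it+\cdots+(-x_it)^s\big)^{ -1},\qquad \sum_{k\ge0}E_k^{(s)}(x_1,\ldots,x_n)t^k=\prod_{i=1}^n\big(1+x_it+\cdots+(x_it)^s\big).$$ -}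

module Defs where

open import Algebra.Bundles using (CommutativeRing)
open import Data.Nat using (ℕ; zero; suc; _∸_; _≤ᵇ_)
open import Data.Fin as Fin using (Fin)
open import Data.Bool using (if_then_else_)

-- Formal power series over a commutative ring R, represented by their
-- coefficient sequences ℕ → Carrier.
module Series {c ℓ} (R : CommutativeRing c ℓ) where
  open CommutativeRing R hiding (zero)

  Seq : Set c
  Seq = ℕ → Carrier

  pow : Carrier → ℕ → Carrier
  pow x zero    = 1#
  pow x (suc j) = x * pow x j

  natMul : ℕ → Carrier → Carrier
  natMul zero    a = 0#
  natMul (suc m) a = a + natMul m a

  sumTo : ℕ → (ℕ → Carrier) → Carrier
  sumTo zero    f = f 0
  sumTo (suc m) f = sumTo m f + f (suc m)

  sign : ℕ → Carrier
  sign k = pow (- 1#) k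

  _⊛_ : Seq → Seq → Seq
  (f ⊛ g) m = sumTo m (λ i → f i * g (m ∸ i))

  one : Seq
  one zero    = 1#
  one (suc _) = 0#

  prodFin : (n : ℕ) → (Fin n → Seq) → Seq
  prodFin zero    F = one
  prodFin (suc n) F = F Fin.zero ⊛ prodFin n (λ i → F (Fin.suc i))

  truncGeom : ℕ → Carrier → Seq
  truncGeom s y j = if j ≤ᵇ s then pow y j else 0#

  -- Multiplicative inverse of a power series f with constant term 1:
  -- g 0 = 1,  g m = - Σ_{j=1}^{m} f j * g (m - j).
  -- invUpTo f m i is correct for i ≤ m.
  invUpTo : Seq → ℕ → Seq
  invUpTo f zero    zero    = 1#
  invUpTo f zero    (suc _) = 0#
  invUpTo f (suc m) i =
    if i ≤ᵇ m then invUpTo f m i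
    else - sumTo m (λ j → f (suc j) * invUpTo f m (m ∸ j))

  inv1 : Seq → Seq
  inv1 f m = invUpTo f m m

  E : (s n : ℕ) → (Fin n → Carrier) → ℕ → Carrier
  E s n x = prodFin n (λ i → truncGeom s (x i))

  H : (s n : ℕ) → (Fin n → Carrier) → ℕ → Carrier
  H s n x = inv1 (prodFin n (λ i → truncGeom s (- x i)))

  Sum3 : ℕ → (ℕ → ℕ → ℕ → Carrier) → Carrier
  Sum3 k F = sumTo k (λ k1 → sumTo (k ∸ k1) (λ k2 → F k1 k2 ((k ∸ k1) ∸ k2)))

-- Write P(t) = ∏ᵢ (1 - xᵢt + ⋯ + (-xᵢt)^s), so that H = 1/P and E(t) = P(-t); hence
-- E(t) H(-t) = 1.  Apply the Euler operator θ = t d/dt.  The first sum is the t^k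
-- coefficient of (θE·E + E·θE)·H(-t) = 2 θE·(E·H(-t)) = 2 θE.  The second sum is the
-- t^k coefficient of -H·H·θP, and θ(H P) = θ1 = 0 gives H·θP = -θH·P, so -H·H·θP = θH.
module Submission where

open import Defs
open import Algebra.Bundles using (CommutativeRing)
open import Data.Nat as ℕ using (ℕ)
open import Data.Fin using (Fin)
open import Data.Product using (_×_; _,_)
open import Data.Bool using (true; false)
open import Data.Empty using (⊥-elim)
open import Data.Sum using (inj₁; inj₂)
import Data.Fin as Fin
import Data.Nat.Properties as ℕₚ
open import Relation.Binary.PropositionalEquality as P using (_≡_)
import Algebra.Properties.CommutativeSemigroup as CommutativeSemigroupProperties
import Algebra.Properties.Ring as RingProperties
import Algebra.Properties.Semiring.Mult as SemiringMult
import Algebra.Properties.CommutativeMonoid.Mult as CommutativeMonoidMult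
import Algebra.Properties.Semiring.Exp as SemiringExp
import Relation.Binary.Reasoning.Setoid as SetoidReasoning

module _ {c ℓ} (R : CommutativeRing c ℓ) where
  open CommutativeRing R hiding (zero)
  open Series R
  open SetoidReasoning setoid
  open RingProperties ring using (-1*x≈-x; -‿involutive; -‿+-comm; -‿distribˡ-*; -‿distribʳ-*; +-inverseʳ-unique)
  open SemiringMult semiring using (×-congʳ; ×-homo-+; ×-comm-*; ×-assoc-*) renaming (_×_ to _·_)
  open CommutativeMonoidMult +-commutativeMonoid using (×-distrib-+)
  open SemiringExp semiring using (_^_; ^-homo-*)
  module +-CS = CommutativeSemigroupProperties +-commutativeSemigroup
  module *-CS = CommutativeSemigroupProperties *-commutativeSemigroup

  natMul≡· : ∀ m a → natMul m a ≡ m · a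
  natMul≡· ℕ.zero    a = P.refl
  natMul≡· (ℕ.suc m) a = P.cong (a +_) (natMul≡· m a)

  pow≡^ : ∀ x j → pow x j ≡ x ^ j
  pow≡^ x ℕ.zero    = P.refl
  pow≡^ x (ℕ.suc j) = P.cong (x *_) (pow≡^ x j)

  sign-+ : ∀ i j → sign (i ℕ.+ j) ≈ sign i * sign j
  sign-+ i j rewrite pow≡^ (- 1#) (i ℕ.+ j) | pow≡^ (- 1#) i | pow≡^ (- 1#) j = ^-homo-* (- 1#) i j

  sign-square : ∀ j → sign j * sign j ≈ 1#
  sign-square ℕ.zero    = *-identityˡ 1#
  sign-square (ℕ.suc j) = begin
    (- 1# * sign j) * (- 1# * sign j) ≈⟨ *-CS.interchange (- 1#) (sign j) (- 1#) (sign j) ⟩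
    (- 1# * - 1#) * (sign j * sign j) ≈⟨ *-cong (trans (-1*x≈-x (- 1#)) (-‿involutive 1#)) (sign-square j) ⟩
    1# * 1#                           ≈⟨ *-identityˡ 1# ⟩
    1#                                ∎

  pow-negate : ∀ y j → pow (- y) j ≈ sign j * pow y j
  pow-negate y ℕ.zero    = sym (*-identityˡ 1#)
  pow-negate y (ℕ.suc j) = begin
    - y * pow (- y) j               ≈⟨ *-cong (sym (-1*x≈-x y)) (pow-negate y j) ⟩
    (- 1# * y) * (sign j * pow y j) ≈⟨ *-CS.interchange (- 1#) y (sign j) (pow y j) ⟩
    sign (ℕ.suc j) * pow y (ℕ.suc j) ∎

  sumTo-congᵇ : ∀ m {f g : ℕ → Carrier} → (∀ {i} → i ℕ.≤ m → f i ≈ g i) → sumTo m f ≈ sumTo m g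
  sumTo-congᵇ ℕ.zero    f≈g = f≈g ℕ.z≤n
  sumTo-congᵇ (ℕ.suc m) f≈g = +-cong (sumTo-congᵇ m (λ i≤m → f≈g (ℕₚ.m≤n⇒m≤1+n i≤m))) (f≈g ℕₚ.≤-refl)

  sumTo-cong : ∀ m {f g : ℕ → Carrier} → (∀ i → f i ≈ g i) → sumTo m f ≈ sumTo m g
  sumTo-cong m f≈g = sumTo-congᵇ m (λ {i} _ → f≈g i)

  sumTo-distrib-+ : ∀ m (f g : ℕ → Carrier) → sumTo m (λ i → f i + g i) ≈ sumTo m f + sumTo m g
  sumTo-distrib-+ ℕ.zero    f g = refl
  sumTo-distrib-+ (ℕ.suc m) f g = trans (+-congʳ (sumTo-distrib-+ m f g)) (+-CS.interchange _ _ _ _)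

  sumTo-negate : ∀ m (f : ℕ → Carrier) → sumTo m (λ i → - f i) ≈ - sumTo m f
  sumTo-negate ℕ.zero    f = refl
  sumTo-negate (ℕ.suc m) f = trans (+-congʳ (sumTo-negate m f)) (-‿+-comm _ _)

  sumTo-distribˡ-* : ∀ m a (f : ℕ → Carrier) → a * sumTo m f ≈ sumTo m (λ i → a * f i)
  sumTo-distribˡ-* ℕ.zero    a f = refl
  sumTo-distribˡ-* (ℕ.suc m) a f = trans (distribˡ a _ _) (+-congʳ (sumTo-distribˡ-* m a f))

  sumTo-distribʳ-* : ∀ m a (f : ℕ → Carrier) → sumTo m f * a ≈ sumTo m (λ i → f i * a)
  sumTo-distribʳ-* ℕ.zero    a f = refl
  sumTo-distribʳ-* (ℕ.suc m) a f = trans (distribʳ a _ _) (+-congʳ (sumTo-distribʳ-* m a f))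

  sumTo-zero : ∀ m (f : ℕ → Carrier) → (∀ i → f i ≈ 0#) → sumTo m f ≈ 0#
  sumTo-zero ℕ.zero    f f≈0 = f≈0 0
  sumTo-zero (ℕ.suc m) f f≈0 = trans (+-cong (sumTo-zero m f f≈0) (f≈0 _)) (+-identityˡ 0#)

  sumTo-unfoldˡ : ∀ m (f : ℕ → Carrier) → sumTo (ℕ.suc m) f ≈ f 0 + sumTo m (λ i → f (ℕ.suc i))
  sumTo-unfoldˡ ℕ.zero    f = refl
  sumTo-unfoldˡ (ℕ.suc m) f = trans (+-congʳ (sumTo-unfoldˡ m f)) (+-assoc _ _ _)

  sumTo-reverse : ∀ m (f : ℕ → Carrier) → sumTo m f ≈ sumTo m (λ i → f (m ℕ.∸ i))
  sumTo-reverse ℕ.zero    f = refl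
  sumTo-reverse (ℕ.suc m) f = begin
    sumTo m f + f (ℕ.suc m)                      ≈⟨ +-comm _ _ ⟩
    f (ℕ.suc m) + sumTo m f                      ≈⟨ +-congˡ (sumTo-reverse m f) ⟩
    f (ℕ.suc m) + sumTo m (λ i → f (m ℕ.∸ i))    ≈⟨ sumTo-unfoldˡ m (λ i → f (ℕ.suc m ℕ.∸ i)) ⟨
    sumTo (ℕ.suc m) (λ i → f (ℕ.suc m ℕ.∸ i))    ∎

  sumTo-triangle : ∀ m (g : ℕ → ℕ → Carrier) →
    sumTo m (λ i → sumTo i (g i)) ≈ sumTo m (λ j → sumTo (m ℕ.∸ j) (λ l → g (j ℕ.+ l) j))
  sumTo-triangle ℕ.zero    g = refl
  sumTo-triangle (ℕ.suc m) g = begin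
    sumTo m (λ i → sumTo i (g i)) + sumTo (ℕ.suc m) (g (ℕ.suc m))
      ≈⟨ +-congʳ (sumTo-triangle m g) ⟩
    sumTo m column + (sumTo m (g (ℕ.suc m)) + g (ℕ.suc m) (ℕ.suc m))
      ≈⟨ +-assoc _ _ _ ⟨
    (sumTo m column + sumTo m (g (ℕ.suc m))) + g (ℕ.suc m) (ℕ.suc m)
      ≈⟨ +-cong (sym (sumTo-distrib-+ m column (g (ℕ.suc m)))) (reflexive (P.sym lastColumn)) ⟩
    sumTo m (λ j → column j + g (ℕ.suc m) j) + sumTo (m ℕ.∸ m) (λ l → g (ℕ.suc m ℕ.+ l) (ℕ.suc m))
      ≈⟨ +-congʳ (sumTo-congᵇ m (λ j≤m → sym (extendColumn j≤m))) ⟩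
    sumTo (ℕ.suc m) (λ j → sumTo (ℕ.suc m ℕ.∸ j) (λ l → g (j ℕ.+ l) j)) ∎
    where
    column : ℕ → Carrier
    column j = sumTo (m ℕ.∸ j) (λ l → g (j ℕ.+ l) j)

    extendColumn : ∀ {j} → j ℕ.≤ m →
      sumTo (ℕ.suc m ℕ.∸ j) (λ l → g (j ℕ.+ l) j) ≈ column j + g (ℕ.suc m) j
    extendColumn {j} j≤m rewrite ℕₚ.+-∸-assoc 1 j≤m =
      +-congˡ (reflexive (P.cong (λ i → g i j) (P.trans (ℕₚ.+-suc j (m ℕ.∸ j)) (P.cong ℕ.suc (ℕₚ.m+[n∸m]≡n j≤m)))))

    lastColumn : sumTo (m ℕ.∸ m) (λ l → g (ℕ.suc m ℕ.+ l) (ℕ.suc m)) ≡ g (ℕ.suc m) (ℕ.suc m)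
    lastColumn rewrite ℕₚ.n∸n≡0 m | ℕₚ.+-identityʳ m = P.refl

  Sum3-cong : ∀ k {F G : ℕ → ℕ → ℕ → Carrier} → (∀ a b d → F a b d ≈ G a b d) → Sum3 k F ≈ Sum3 k G
  Sum3-cong k F≈G = sumTo-cong k (λ a → sumTo-cong (k ℕ.∸ a) (λ b → F≈G _ _ _))

  Sum3-distrib-+ : ∀ k (F G : ℕ → ℕ → ℕ → Carrier) →
    Sum3 k (λ a b d → F a b d + G a b d) ≈ Sum3 k F + Sum3 k G
  Sum3-distrib-+ k F G = trans (sumTo-cong k (λ a → sumTo-distrib-+ (k ℕ.∸ a) _ _)) (sumTo-distrib-+ k _ _)

  Sum3-negate : ∀ k (F : ℕ → ℕ → ℕ → Carrier) → Sum3 k (λ a b d → - F a b d) ≈ - Sum3 k F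
  Sum3-negate k F = trans (sumTo-cong k (λ a → sumTo-negate (k ℕ.∸ a) _)) (sumTo-negate k _)

  infix 4 _≈ₛ_
  _≈ₛ_ : Seq → Seq → Set ℓ
  f ≈ₛ g = ∀ m → f m ≈ g m

  ⊛-cong : ∀ {f f′ g g′} → f ≈ₛ f′ → g ≈ₛ g′ → f ⊛ g ≈ₛ f′ ⊛ g′
  ⊛-cong f≈f′ g≈g′ m = sumTo-cong m (λ i → *-cong (f≈f′ i) (g≈g′ (m ℕ.∸ i)))

  ⊛-congˡ : ∀ f {g g′} → g ≈ₛ g′ → f ⊛ g ≈ₛ f ⊛ g′
  ⊛-congˡ f = ⊛-cong {f = f} {f′ = f} (λ _ → refl)

  ⊛-congʳ : ∀ {f f′} g → f ≈ₛ f′ → f ⊛ g ≈ₛ f′ ⊛ g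
  ⊛-congʳ g f≈f′ = ⊛-cong {g = g} {g′ = g} f≈f′ (λ _ → refl)

  ⊛-comm : ∀ f g → f ⊛ g ≈ₛ g ⊛ f
  ⊛-comm f g m = begin
    sumTo m (λ i → f i * g (m ℕ.∸ i))                      ≈⟨ sumTo-reverse m _ ⟩
    sumTo m (λ i → f (m ℕ.∸ i) * g (m ℕ.∸ (m ℕ.∸ i)))      ≈⟨ sumTo-congᵇ m swap ⟩
    sumTo m (λ i → g i * f (m ℕ.∸ i))                      ∎
    where
    swap : ∀ {i} → i ℕ.≤ m → f (m ℕ.∸ i) * g (m ℕ.∸ (m ℕ.∸ i)) ≈ g i * f (m ℕ.∸ i)
    swap i≤m = trans (*-comm _ _) (*-congʳ (reflexive (P.cong g (ℕₚ.m∸[m∸n]≡n i≤m))))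

  ⊛-assoc : ∀ f g h → (f ⊛ g) ⊛ h ≈ₛ f ⊛ (g ⊛ h)
  ⊛-assoc f g h m = begin
    sumTo m (λ i → sumTo i (λ j → f j * g (i ℕ.∸ j)) * h (m ℕ.∸ i))
      ≈⟨ sumTo-cong m (λ i → sumTo-distribʳ-* i _ _) ⟩
    sumTo m (λ i → sumTo i (λ j → f j * g (i ℕ.∸ j) * h (m ℕ.∸ i)))
      ≈⟨ sumTo-triangle m _ ⟩
    sumTo m (λ j → sumTo (m ℕ.∸ j) (λ l → f j * g ((j ℕ.+ l) ℕ.∸ j) * h (m ℕ.∸ (j ℕ.+ l))))
      ≈⟨ sumTo-cong m (λ j → sumTo-cong (m ℕ.∸ j) (λ l → trans (*-assoc _ _ _) (*-congˡ (reindex j l)))) ⟩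
    sumTo m (λ j → sumTo (m ℕ.∸ j) (λ l → f j * (g l * h ((m ℕ.∸ j) ℕ.∸ l))))
      ≈⟨ sumTo-cong m (λ j → sumTo-distribˡ-* (m ℕ.∸ j) (f j) _) ⟨
    sumTo m (λ j → f j * sumTo (m ℕ.∸ j) (λ l → g l * h ((m ℕ.∸ j) ℕ.∸ l))) ∎
    where
    reindex : ∀ j l → g ((j ℕ.+ l) ℕ.∸ j) * h (m ℕ.∸ (j ℕ.+ l)) ≈ g l * h ((m ℕ.∸ j) ℕ.∸ l)
    reindex j l = *-cong (reflexive (P.cong g (ℕₚ.m+n∸m≡n j l)))
                         (reflexive (P.cong h (P.sym (ℕₚ.∸-+-assoc m j l))))

  ⊛-identityˡ : ∀ g → one ⊛ g ≈ₛ g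
  ⊛-identityˡ g ℕ.zero    = *-identityˡ _
  ⊛-identityˡ g (ℕ.suc m) = begin
    sumTo (ℕ.suc m) (λ i → one i * g (ℕ.suc m ℕ.∸ i))        ≈⟨ sumTo-unfoldˡ m _ ⟩
    1# * g (ℕ.suc m) + sumTo m (λ i → 0# * g (m ℕ.∸ i))      ≈⟨ +-cong (*-identityˡ _) (sumTo-zero m _ (λ _ → zeroˡ _)) ⟩
    g (ℕ.suc m) + 0#                                          ≈⟨ +-identityʳ _ ⟩
    g (ℕ.suc m)                                               ∎

  ⊛-identityʳ : ∀ g → g ⊛ one ≈ₛ g
  ⊛-identityʳ g m = trans (⊛-comm g one m) (⊛-identityˡ g m)

  ⊛-negateʳ : ∀ f g → f ⊛ (λ m → - g m) ≈ₛ (λ m → - (f ⊛ g) m)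
  ⊛-negateʳ f g m = trans (sumTo-cong m (λ i → sym (-‿distribʳ-* _ _))) (sumTo-negate m _)

  ⊛-leftComm : ∀ f g h → f ⊛ (g ⊛ h) ≈ₛ g ⊛ (f ⊛ h)
  ⊛-leftComm f g h m = begin
    (f ⊛ (g ⊛ h)) m ≈⟨ ⊛-assoc f g h m ⟨
    ((f ⊛ g) ⊛ h) m ≈⟨ ⊛-congʳ h (⊛-comm f g) m ⟩
    ((g ⊛ f) ⊛ h) m ≈⟨ ⊛-assoc g f h m ⟩
    (g ⊛ (f ⊛ h)) m ∎

  Sum3-⊛ : ∀ k (f g h : Seq) → Sum3 k (λ a b d → f a * (g b * h d)) ≈ (f ⊛ (g ⊛ h)) k
  Sum3-⊛ k f g h = sumTo-cong k (λ a → sym (sumTo-distribˡ-* (k ℕ.∸ a) (f a) _))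

  invUpTo-stable : ∀ f {m i} → i ℕ.≤ m → invUpTo f m i ≡ inv1 f i
  invUpTo-stable f {ℕ.zero}  ℕ.z≤n = P.refl
  invUpTo-stable f {ℕ.suc m} {i} i≤1+m with ℕₚ.m≤n⇒m<n∨m≡n i≤1+m
  ... | inj₂ P.refl = P.refl
  ... | inj₁ (ℕ.s≤s i≤m) with i ℕ.≤ᵇ m | ℕₚ.≤⇒≤ᵇ i≤m
  ...   | true  | _  = invUpTo-stable f i≤m
  ...   | false | ()

  inv1-suc : ∀ f m → inv1 f (ℕ.suc m) ≡ - sumTo m (λ j → f (ℕ.suc j) * invUpTo f m (m ℕ.∸ j))
  inv1-suc f m with ℕ.suc m ℕ.≤ᵇ m | ℕₚ.≤ᵇ⇒≤ (ℕ.suc m) m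
  ... | false | _     = P.refl
  ... | true  | 1+m≤m = ⊥-elim (ℕₚ.n≮n m (1+m≤m _))

  inv1-inverseʳ : ∀ f → f 0 ≈ 1# → f ⊛ inv1 f ≈ₛ one
  inv1-inverseʳ f f0≈1 ℕ.zero    = trans (*-identityʳ _) f0≈1
  inv1-inverseʳ f f0≈1 (ℕ.suc m) = begin
    sumTo (ℕ.suc m) (λ i → f i * inv1 f (ℕ.suc m ℕ.∸ i)) ≈⟨ sumTo-unfoldˡ m _ ⟩
    f 0 * inv1 f (ℕ.suc m) + rest                         ≈⟨ +-congʳ (*-cong f0≈1 (reflexive (inv1-suc f m))) ⟩
    1# * - rest′ + rest                                   ≈⟨ +-congʳ (trans (*-identityˡ _) (-‿cong rest′≈rest)) ⟩
    - rest + rest                                         ≈⟨ -‿inverseˡ rest ⟩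
    0#                                                    ∎
    where
    rest rest′ : Carrier
    rest  = sumTo m (λ j → f (ℕ.suc j) * inv1 f (m ℕ.∸ j))
    rest′ = sumTo m (λ j → f (ℕ.suc j) * invUpTo f m (m ℕ.∸ j))

    rest′≈rest : rest′ ≈ rest
    rest′≈rest = sumTo-cong m (λ j → *-congˡ (reflexive (invUpTo-stable f (ℕₚ.m∸n≤m m j))))

  -- f(t) ↦ f(-t)
  alternate : Seq → Seq
  alternate f m = sign m * f m

  alternate-cong : ∀ {f g} → f ≈ₛ g → alternate f ≈ₛ alternate g
  alternate-cong f≈g m = *-congˡ (f≈g m)

  alternate-involutive : ∀ f → alternate (alternate f) ≈ₛ f
  alternate-involutive f m = trans (sym (*-assoc _ _ _)) (trans (*-congʳ (sign-square m)) (*-identityˡ _))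

  alternate-one : alternate one ≈ₛ one
  alternate-one ℕ.zero    = *-identityˡ _
  alternate-one (ℕ.suc m) = zeroʳ _

  alternate-⊛ : ∀ f g → alternate (f ⊛ g) ≈ₛ alternate f ⊛ alternate g
  alternate-⊛ f g m = trans (sumTo-distribˡ-* m (sign m) _) (sumTo-congᵇ m splitSign)
    where
    splitSign : ∀ {i} → i ℕ.≤ m → sign m * (f i * g (m ℕ.∸ i)) ≈ (sign i * f i) * (sign (m ℕ.∸ i) * g (m ℕ.∸ i))
    splitSign {i} i≤m = begin
      sign m * (f i * g (m ℕ.∸ i))
        ≈⟨ *-congʳ (trans (reflexive (P.cong sign (P.sym (ℕₚ.m+[n∸m]≡n i≤m)))) (sign-+ i (m ℕ.∸ i))) ⟩
      (sign i * sign (m ℕ.∸ i)) * (f i * g (m ℕ.∸ i))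
        ≈⟨ *-CS.interchange _ _ _ _ ⟩
      (sign i * f i) * (sign (m ℕ.∸ i) * g (m ℕ.∸ i)) ∎

  alternate-inverse : ∀ {p h} → p ⊛ h ≈ₛ one → alternate p ⊛ alternate h ≈ₛ one
  alternate-inverse {p} {h} p⊛h≈1 m = begin
    (alternate p ⊛ alternate h) m ≈⟨ alternate-⊛ p h m ⟨
    alternate (p ⊛ h) m           ≈⟨ alternate-cong p⊛h≈1 m ⟩
    alternate one m               ≈⟨ alternate-one m ⟩
    one m                         ∎

  θ : Seq → Seq
  θ f m = m · f m

  ·-distrib-sumTo : ∀ m n (f : ℕ → Carrier) → m · sumTo n f ≈ sumTo n (λ i → m · f i)
  ·-distrib-sumTo m ℕ.zero    f = refl
  ·-distrib-sumTo m (ℕ.suc n) f = trans (×-distrib-+ _ _ m) (+-congʳ (·-distrib-sumTo m n f))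

  θ-one : θ one ≈ₛ (λ _ → 0#)
  θ-one ℕ.zero    = refl
  θ-one (ℕ.suc m) = ·-zero (ℕ.suc m)
    where
    ·-zero : ∀ n → n · 0# ≈ 0#
    ·-zero ℕ.zero    = refl
    ·-zero (ℕ.suc n) = trans (+-identityˡ _) (·-zero n)

  θ-⊛ : ∀ f g → θ (f ⊛ g) ≈ₛ (λ m → (θ f ⊛ g) m + (f ⊛ θ g) m)
  θ-⊛ f g m = begin
    m · sumTo m (λ i → f i * g (m ℕ.∸ i))                                  ≈⟨ ·-distrib-sumTo m m _ ⟩
    sumTo m (λ i → m · (f i * g (m ℕ.∸ i)))                                ≈⟨ sumTo-congᵇ m leibniz ⟩
    sumTo m (λ i → (θ f i) * g (m ℕ.∸ i) + f i * θ g (m ℕ.∸ i))            ≈⟨ sumTo-distrib-+ m _ _ ⟩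
    (θ f ⊛ g) m + (f ⊛ θ g) m                                              ∎
    where
    leibniz : ∀ {i} → i ℕ.≤ m → m · (f i * g (m ℕ.∸ i)) ≈ (θ f i) * g (m ℕ.∸ i) + f i * θ g (m ℕ.∸ i)
    leibniz {i} i≤m = begin
      m · (f i * g (m ℕ.∸ i))                                  ≡⟨ P.cong (_· (f i * g (m ℕ.∸ i))) (ℕₚ.m+[n∸m]≡n i≤m) ⟨
      (i ℕ.+ (m ℕ.∸ i)) · (f i * g (m ℕ.∸ i))                  ≈⟨ ×-homo-+ _ i (m ℕ.∸ i) ⟩
      i · (f i * g (m ℕ.∸ i)) + (m ℕ.∸ i) · (f i * g (m ℕ.∸ i)) ≈⟨ +-cong (sym (×-assoc-* i _ _)) (sym (×-comm-* (m ℕ.∸ i) _ _)) ⟩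
      (θ f i) * g (m ℕ.∸ i) + f i * θ g (m ℕ.∸ i)              ∎

  θ-cong : ∀ {f g} → f ≈ₛ g → θ f ≈ₛ θ g
  θ-cong f≈g m = ×-congʳ m (f≈g m)

  θ-inverse : ∀ {p h} → p ⊛ h ≈ₛ one → h ⊛ (h ⊛ θ p) ≈ₛ (λ m → - θ h m)
  θ-inverse {p} {h} p⊛h≈1 m = begin
    (h ⊛ (h ⊛ θ p)) m                 ≈⟨ ⊛-congˡ h h⊛θp≈-θh⊛p m ⟩
    (h ⊛ (λ j → - (θ h ⊛ p) j)) m     ≈⟨ ⊛-negateʳ h (θ h ⊛ p) m ⟩
    - (h ⊛ (θ h ⊛ p)) m               ≈⟨ -‿cong (⊛-leftComm h (θ h) p m) ⟩
    - (θ h ⊛ (h ⊛ p)) m               ≈⟨ -‿cong (⊛-congˡ (θ h) h⊛p≈1 m) ⟩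
    - (θ h ⊛ one) m                   ≈⟨ -‿cong (⊛-identityʳ (θ h) m) ⟩
    - θ h m                           ∎
    where
    h⊛p≈1 : h ⊛ p ≈ₛ one
    h⊛p≈1 j = trans (⊛-comm h p j) (p⊛h≈1 j)

    h⊛θp≈-θh⊛p : h ⊛ θ p ≈ₛ (λ j → - (θ h ⊛ p) j)
    h⊛θp≈-θh⊛p j = +-inverseʳ-unique _ _
      (trans (sym (θ-⊛ h p j)) (trans (θ-cong h⊛p≈1 j) (θ-one j)))

  doubled-θ-expansion : ∀ {p h e} → p ⊛ h ≈ₛ one → e ≈ₛ alternate p → ∀ k →
    natMul (k ℕ.+ k) (e k) ≈ Sum3 k (λ a b d → sign d * natMul (a ℕ.+ b) (e a * e b * h d))
  doubled-θ-expansion {p} {h} {e} p⊛h≈1 e≈p̃ k = sym (begin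
    Sum3 k (λ a b d → sign d * natMul (a ℕ.+ b) (e a * e b * h d))
      ≈⟨ Sum3-cong k leibniz ⟩
    Sum3 k (λ a b d → θ e a * (e b * h̃ d) + e a * (θ e b * h̃ d))
      ≈⟨ Sum3-distrib-+ k (λ a b d → θ e a * (e b * h̃ d)) (λ a b d → e a * (θ e b * h̃ d)) ⟩
    Sum3 k (λ a b d → θ e a * (e b * h̃ d)) + Sum3 k (λ a b d → e a * (θ e b * h̃ d))
      ≈⟨ +-cong (Sum3-⊛ k (θ e) e h̃) (Sum3-⊛ k e (θ e) h̃) ⟩
    (θ e ⊛ (e ⊛ h̃)) k + (e ⊛ (θ e ⊛ h̃)) k
      ≈⟨ +-congˡ (⊛-leftComm e (θ e) h̃ k) ⟩
    (θ e ⊛ (e ⊛ h̃)) k + (θ e ⊛ (e ⊛ h̃)) k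
      ≈⟨ +-cong (θe⊛[e⊛h̃]≈θe k) (θe⊛[e⊛h̃]≈θe k) ⟩
    θ e k + θ e k
      ≈⟨ ×-homo-+ (e k) k k ⟨
    (k ℕ.+ k) · e k
      ≡⟨ natMul≡· (k ℕ.+ k) (e k) ⟨
    natMul (k ℕ.+ k) (e k) ∎)
    where
    h̃ : Seq
    h̃ = alternate h

    θe⊛[e⊛h̃]≈θe : θ e ⊛ (e ⊛ h̃) ≈ₛ θ e
    θe⊛[e⊛h̃]≈θe m = trans (⊛-congˡ (θ e) (λ j → trans (⊛-congʳ h̃ e≈p̃ j) (alternate-inverse {p} {h} p⊛h≈1 j)) m)
                          (⊛-identityʳ (θ e) m)

    leibniz : ∀ a b d → sign d * natMul (a ℕ.+ b) (e a * e b * h d) ≈ θ e a * (e b * h̃ d) + e a * (θ e b * h̃ d)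
    leibniz a b d = begin
      sign d * natMul (a ℕ.+ b) (e a * e b * h d)        ≡⟨ P.cong (sign d *_) (natMul≡· (a ℕ.+ b) _) ⟩
      sign d * ((a ℕ.+ b) · (e a * e b * h d))           ≈⟨ ×-comm-* (a ℕ.+ b) _ _ ⟩
      (a ℕ.+ b) · (sign d * (e a * e b * h d))           ≈⟨ ×-congʳ (a ℕ.+ b) (trans (*-CS.x∙yz≈y∙xz _ _ _) (*-assoc _ _ _)) ⟩
      (a ℕ.+ b) · (e a * (e b * h̃ d))                    ≈⟨ ×-homo-+ _ a b ⟩
      a · (e a * (e b * h̃ d)) + b · (e a * (e b * h̃ d)) ≈⟨ +-cong (sym (×-assoc-* a _ _))
                                                              (trans (sym (×-comm-* b _ _)) (*-congˡ (sym (×-assoc-* b _ _)))) ⟩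
      θ e a * (e b * h̃ d) + e a * (θ e b * h̃ d)          ∎

  θ-inverse-expansion : ∀ {p h e} → p ⊛ h ≈ₛ one → e ≈ₛ alternate p → ∀ k →
    natMul k (h k) ≈ Sum3 k (λ a b d → (- sign d) * natMul d (h a * h b * e d))
  θ-inverse-expansion {p} {h} {e} p⊛h≈1 e≈p̃ k = sym (begin
    Sum3 k (λ a b d → (- sign d) * natMul d (h a * h b * e d)) ≈⟨ Sum3-cong k regroup ⟩
    Sum3 k (λ a b d → - (h a * (h b * θ p d)))                 ≈⟨ Sum3-negate k (λ a b d → h a * (h b * θ p d)) ⟩
    - Sum3 k (λ a b d → h a * (h b * θ p d))                   ≈⟨ -‿cong (Sum3-⊛ k h h (θ p)) ⟩
    - (h ⊛ (h ⊛ θ p)) k                                        ≈⟨ -‿cong (θ-inverse p⊛h≈1 k) ⟩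
    - - θ h k                                                  ≈⟨ -‿involutive _ ⟩
    k · h k                                                    ≡⟨ natMul≡· k (h k) ⟨
    natMul k (h k)                                             ∎)
    where
    sign*e≈p : ∀ d → sign d * e d ≈ p d
    sign*e≈p d = trans (*-congˡ (e≈p̃ d)) (alternate-involutive p d)

    regroup : ∀ a b d → (- sign d) * natMul d (h a * h b * e d) ≈ - (h a * (h b * θ p d))
    regroup a b d = begin
      (- sign d) * natMul d (h a * h b * e d)     ≡⟨ P.cong (- sign d *_) (natMul≡· d _) ⟩
      (- sign d) * (d · (h a * h b * e d))        ≈⟨ -‿distribˡ-* _ _ ⟨
      - (sign d * (d · (h a * h b * e d)))        ≈⟨ -‿cong (×-comm-* d _ _) ⟩
      - (d · (sign d * (h a * h b * e d)))        ≈⟨ -‿cong (×-congʳ d absorbSign) ⟩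
      - (d · (h a * (h b * p d)))                 ≈⟨ -‿cong (trans (sym (×-comm-* d _ _)) (*-congˡ (sym (×-comm-* d _ _)))) ⟩
      - (h a * (h b * θ p d))                     ∎
      where
      absorbSign : sign d * (h a * h b * e d) ≈ h a * (h b * p d)
      absorbSign = begin
        sign d * ((h a * h b) * e d) ≈⟨ *-CS.x∙yz≈y∙xz _ _ _ ⟩
        (h a * h b) * (sign d * e d) ≈⟨ *-assoc _ _ _ ⟩
        h a * (h b * (sign d * e d)) ≈⟨ *-congˡ (*-congˡ (sign*e≈p d)) ⟩
        h a * (h b * p d)            ∎

  prodFin-cong : ∀ n {F G : Fin n → Seq} → (∀ i → F i ≈ₛ G i) → prodFin n F ≈ₛ prodFin n G
  prodFin-cong ℕ.zero    F≈G m = refl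
  prodFin-cong (ℕ.suc n) F≈G   = ⊛-cong (F≈G Fin.zero) (prodFin-cong n (λ i → F≈G (Fin.suc i)))

  prodFin-alternate : ∀ n (F : Fin n → Seq) → prodFin n (λ i → alternate (F i)) ≈ₛ alternate (prodFin n F)
  prodFin-alternate ℕ.zero    F m = sym (alternate-one m)
  prodFin-alternate (ℕ.suc n) F m = begin
    (alternate F₀ ⊛ prodFin n (λ i → alternate (F (Fin.suc i)))) m
      ≈⟨ ⊛-congˡ (alternate F₀) (prodFin-alternate n (λ i → F (Fin.suc i))) m ⟩
    (alternate F₀ ⊛ alternate (prodFin n (λ i → F (Fin.suc i)))) m
      ≈⟨ alternate-⊛ F₀ (prodFin n (λ i → F (Fin.suc i))) m ⟨
    alternate (prodFin (ℕ.suc n) F) m ∎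
    where
    F₀ : Seq
    F₀ = F Fin.zero

  prodFin-constantTerm : ∀ n (F : Fin n → Seq) → (∀ i → F i 0 ≈ 1#) → prodFin n F 0 ≈ 1#
  prodFin-constantTerm ℕ.zero    F F0≈1 = refl
  prodFin-constantTerm (ℕ.suc n) F F0≈1 =
    trans (*-cong (F0≈1 Fin.zero) (prodFin-constantTerm n _ (λ i → F0≈1 (Fin.suc i)))) (*-identityˡ 1#)

  truncGeom-negate : ∀ s y → truncGeom s (- y) ≈ₛ alternate (truncGeom s y)
  truncGeom-negate s y j with j ℕ.≤ᵇ s
  ... | true  = pow-negate y j
  ... | false = sym (zeroʳ _)

  E-negate : ∀ s n x → E s n (λ i → - x i) ≈ₛ alternate (E s n x)
  E-negate s n x m =
    trans (prodFin-cong n (λ i → truncGeom-negate s (x i)) m) (prodFin-alternate n (λ i → truncGeom s (x i)) m)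

  E-alternate : ∀ s n x → E s n x ≈ₛ alternate (E s n (λ i → - x i))
  E-alternate s n x m = trans (sym (alternate-involutive (E s n x) m)) (alternate-cong (λ j → sym (E-negate s n x j)) m)

  E-negate⊛H : ∀ s n x → E s n (λ i → - x i) ⊛ H s n x ≈ₛ one
  E-negate⊛H s n x = inv1-inverseʳ _ (prodFin-constantTerm n _ (λ _ → refl))

corollary2p4 : ∀ {c ℓ} (R : CommutativeRing c ℓ) →
    let open CommutativeRing R
        open Series R
    in (k n s : ℕ) → 1 ℕ.≤ k → 1 ℕ.≤ n → 1 ℕ.≤ s → (x : Fin n → Carrier) →
       (natMul (k ℕ.+ k) (E s n x k)
          ≈ Sum3 k (λ k1 k2 k3 → sign k3 * natMul (k1 ℕ.+ k2) (E s n x k1 * E s n x k2 * H s n x k3)))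
       × (natMul k (H s n x k)
          ≈ Sum3 k (λ k1 k2 k3 → (- sign k3) * natMul k3 (H s n x k1 * H s n x k2 * E s n x k3)))
-- The identities hold for every k, n and s.
corollary2p4 R k n s _ _ _ x =
  doubled-θ-expansion R {h = H s n x} (E-negate⊛H R s n x) (E-alternate R s n x) k ,
  θ-inverse-expansion R {h = H s n x} (E-negate⊛H R s n x) (E-alternate R s n x) k
  where open Series R using (H)
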